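{- For every positive integer $k$ there exists $N_k\in\mathbb{N}$ such that for all $n\ge N_k$, $$T(1^k,0^{n-k})\ge(k+1)^{n-1}.$$
   Context: For an $n\times n$ upper-triangular matrix $A=(a_{i,j})$ with nonnegative integer entries and $1\le j\le n$, the $j$-th hook sum is $h_j=(a_{j,j}+\cdots+a_{j,n})-(a_{1,j}+\cdots+a_{j-1,j})$. $T(1^k,0^{n-k})$ is the number of such $n\times n$ matrices with hook sum vector $(1,\ldots,1,0,\ldots,0)$ consisting of $k$ ones followed by $n-k$ zeros. -}

module Defs where

open import Data.Nat using (ℕ; zero; suc; _<_; _<?_)
open import Data.Nat.ListAction using (sum)
open import Data.Integer using (ℤ; +_; _-_)
open import Data.Fin using (Fin; toℕ)
import Data.Fin as Fin
open import Data.List using (List; map; filter; allFin)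
open import Data.Bool using (if_then_else_)
open import Data.Vec using (Vec; lookup)
open import Relation.Binary.PropositionalEquality using (_≡_)
open import Relation.Nullary.Decidable using (does)

Mat : ℕ → Set
Mat n = Vec (Vec ℕ n) n

entry : ∀ {n} → Mat n → Fin n → Fin n → ℕ
entry A i j = lookup (lookup A i) j

UpperTriangular : ∀ {n} → Mat n → Set
UpperTriangular {n} A = (i j : Fin n) → toℕ j < toℕ i → entry A i j ≡ 0

rowTail : ∀ {n} → Mat n → Fin n → ℕ
rowTail {n} A j = sum (map (entry A j) (filter (λ l → j Fin.≤? l) (allFin n)))

colAbove : ∀ {n} → Mat n → Fin n → ℕ
colAbove {n} A j = sum (map (λ i → entry A i j) (filter (λ i → i Fin.<? j) (allFin n)))

hook : ∀ {n} → Mat n → Fin n → ℤ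
hook A j = + rowTail A j - + colAbove A j

onesThenZeros : (n k : ℕ) → Fin n → ℕ
onesThenZeros n k j = if does (toℕ j <? k) then 1 else 0

-- Upper-triangular n×n matrices with hook sum vector (1^k, 0^(n-k)).
-- Proof fields are irrelevant, so two elements are equal iff their matrices are.
record HookMatrix (n k : ℕ) : Set where
  constructor hookMatrix
  field
    mat   : Mat n
    .upper : UpperTriangular mat
    .hooks : (j : Fin n) → hook mat j ≡ + onesThenZeros n k j

module Submission where

-- Deleting the first row (c₀, v) of an upper-triangular matrix with hook vector (a, g)
-- leaves one with hook vector g ⊕ v, where c₀ + Σ v = a.  Hence the number count g of
-- such matrices satisfies count (a ∷ g) = Σ_{c₀ + r = a} Σ_{Σ v = r} count (g ⊕ v); the
-- file first develops the finite sums over splittings and compositions this needs.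
-- Manipulating the recursion gives two growth laws for appending zero hooks:
--   count (g ∷ 0)     ≥ (1 + Σ g) · count g                       (count-growth)
--   count (g ∷ 0 ∷ 0) ≥ (1 + Σ g) · count (g ∷ 0) + count g      (count₂-growth, Σ g ≥ 2).
-- For g = (1^k, 0^(n-k)) these say t (n+1) ≥ (k+1) t n and t (n+2) ≥ (k+1) t (n+1) + t n,
-- and a general lemma on such sequences (SequenceGrowth) yields t n ≥ (k+1)^(n-1) once
-- n ≥ k + 1 + (k+1)^(k+1).  Finally the recursion is realised by an explicit duplicate-free
-- list of matrices (hookMatrices) of length count g, which indexes HookMatrix n k.

open import Defs

open import Data.Nat using (ℕ; zero; suc; _+_; _*_; _^_; _∸_; _≤_; z≤n; s≤s; NonZero)
import Data.Nat as ℕ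
open import Data.Nat.Properties
open import Data.Nat.Tactic.RingSolver using (solve-∀)
open import Algebra.Properties.CommutativeSemigroup +-commutativeSemigroup
  using (interchange; x∙yz≈y∙xz)
open import Data.Integer using (0ℤ; _⊖_)
  renaming (+_ to ⁺_; _+_ to _+ℤ_; _-_ to _-ℤ_; -_ to -ℤ_)
import Data.Integer.Properties as ℤ
open import Data.Bool using (Bool; true; false; if_then_else_)
open import Data.Empty using (⊥; ⊥-elim)
open import Data.Fin using (Fin; zero; suc; toℕ)
import Data.Fin as Fin
open import Data.Product using (Σ; ∃-syntax; _×_; _,_; proj₁; proj₂)
import Data.Product as Product
open import Data.Sum using (_⊎_; inj₁; inj₂)
open import Data.Vec using (Vec; []; _∷_; _∷ʳ_; tail; replicate; zipWith)
import Data.Vec as Vec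
import Data.Vec.Properties as Vec
open import Data.List using (List; []; _∷_; [_]; _++_; map; concatMap; length; filter; tabulate)
import Data.List as List
open import Data.List.Properties using (length-++; map-++; map-∘; map-cong; length-map)
open import Data.Nat.ListAction using (sum)
open import Data.Nat.ListAction.Properties using (sum-++)
open import Data.List.Membership.Propositional using (_∈_; find; lose)
open import Data.List.Membership.Propositional.Properties
  using (∈-map⁺; ∈-map⁻; ∈-concatMap⁺; ∈-concatMap⁻; ∈-lookup)
import Data.List.Membership.DecPropositional as DecMembership
open import Data.List.Relation.Unary.Any using (Any; here; there)
import Data.List.Relation.Unary.Any as Any
open import Data.List.Relation.Unary.Any.Properties using (lookup-index)
open import Data.List.Relation.Unary.All using (All; []; _∷_)
import Data.List.Relation.Unary.All as All
open import Data.List.Relation.Unary.Unique.Propositional using (Unique; []; _∷_)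
import Data.List.Relation.Unary.Unique.Propositional.Properties as Unique
open import Function.Bundles using (_↔_; mk↔ₛ′)
open import Level using (0ℓ)
open import Relation.Binary.PropositionalEquality hiding ([_])
open import Relation.Nullary using (¬_; does)
open import Relation.Nullary.Decidable using (recompute)
open import Relation.Unary using (Pred; Decidable)

-- Σ_{u + l = a} G u l : a sum over the ways of splitting a into two parts.
splitSum : ℕ → (ℕ → ℕ → ℕ) → ℕ
splitSum zero    G = G 0 0
splitSum (suc a) G = G 0 (suc a) + splitSum a (λ u l → G (suc u) l)

splitSum-cong : ∀ a {G H : ℕ → ℕ → ℕ} → (∀ u l → G u l ≡ H u l) → splitSum a G ≡ splitSum a H
splitSum-cong zero    G≡H = G≡H 0 0
splitSum-cong (suc a) G≡H =
  cong₂ _+_ (G≡H 0 (suc a)) (splitSum-cong a (λ u l → G≡H (suc u) l))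

splitSum-mono : ∀ a {G H : ℕ → ℕ → ℕ} →
  (∀ u l → u + l ≡ a → G u l ≤ H u l) → splitSum a G ≤ splitSum a H
splitSum-mono zero    G≤H = G≤H 0 0 refl
splitSum-mono (suc a) G≤H =
  +-mono-≤ (G≤H 0 (suc a) refl) (splitSum-mono a (λ u l eq → G≤H (suc u) l (cong suc eq)))

splitSum-+ : ∀ a (G H : ℕ → ℕ → ℕ) →
  splitSum a (λ u l → G u l + H u l) ≡ splitSum a G + splitSum a H
splitSum-+ zero    G H = refl
splitSum-+ (suc a) G H = trans (cong (G 0 (suc a) + H 0 (suc a) +_) (splitSum-+ a _ _))
                               (interchange (G 0 (suc a)) (H 0 (suc a)) _ _)

splitSum-* : ∀ a m (G : ℕ → ℕ → ℕ) → splitSum a (λ u l → m * G u l) ≡ m * splitSum a G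
splitSum-* zero    m G = refl
splitSum-* (suc a) m G =
  trans (cong (m * G 0 (suc a) +_) (splitSum-* a m _)) (sym (*-distribˡ-+ m _ _))

splitSum-*ʳ : ∀ a m (G : ℕ → ℕ → ℕ) → splitSum a (λ u l → G u l * m) ≡ splitSum a G * m
splitSum-*ʳ a m G = begin
  splitSum a (λ u l → G u l * m) ≡⟨ splitSum-cong a (λ u l → *-comm (G u l) m) ⟩
  splitSum a (λ u l → m * G u l) ≡⟨ splitSum-* a m G ⟩
  m * splitSum a G               ≡⟨ *-comm m (splitSum a G) ⟩
  splitSum a G * m               ∎
  where open ≡-Reasoning

splitSum-last : ∀ a (G : ℕ → ℕ → ℕ) →
  splitSum (suc a) G ≡ G (suc a) 0 + splitSum a (λ u l → G u (suc l))
splitSum-last zero    G = +-comm (G 0 1) (G 1 0)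
splitSum-last (suc a) G =
  trans (cong (G 0 (suc (suc a)) +_) (splitSum-last a (λ u l → G (suc u) l)))
        (x∙yz≈y∙xz (G 0 (suc (suc a))) (G (suc (suc a)) 0) _)

splitSum-lastTerm : ∀ a (G : ℕ → ℕ → ℕ) → G a 0 ≤ splitSum a G
splitSum-lastTerm zero    G = ≤-refl
splitSum-lastTerm (suc a) G = ≤-trans (m≤m+n _ _) (≤-reflexive (sym (splitSum-last a G)))

splitSum-swap : ∀ a (G : ℕ → ℕ → ℕ) → splitSum a G ≡ splitSum a (λ u l → G l u)
splitSum-swap zero    G = refl
splitSum-swap (suc a) G =
  trans (cong (G 0 (suc a) +_) (splitSum-swap a (λ u l → G (suc u) l)))
        (sym (splitSum-last a (λ u l → G l u)))

-- Both sides are Σ_{x + m + l = a} H x m l, grouped as x + (m + l) and (x + m) + l.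
splitSum-assoc : ∀ a (H : ℕ → ℕ → ℕ → ℕ) →
  splitSum a (λ x r → splitSum r (λ m l → H x m l)) ≡ splitSum a (λ s l → splitSum s (λ x m → H x m l))
splitSum-assoc zero    H = refl
splitSum-assoc (suc a) H = begin
  splitSum (suc a) (λ m l → H 0 m l) + splitSum a (λ x r → splitSum r (λ m l → H (suc x) m l))
    ≡⟨ cong (splitSum (suc a) (λ m l → H 0 m l) +_) (splitSum-assoc a (λ x → H (suc x))) ⟩
  (H 0 0 (suc a) + splitSum a (λ m l → H 0 (suc m) l)) + splitSum a (λ s l → splitSum s (λ x m → H (suc x) m l))
    ≡⟨ +-assoc (H 0 0 (suc a)) _ _ ⟩
  H 0 0 (suc a) + (splitSum a (λ m l → H 0 (suc m) l) + splitSum a (λ s l → splitSum s (λ x m → H (suc x) m l)))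
    ≡⟨ cong (H 0 0 (suc a) +_) (sym (splitSum-+ a _ _)) ⟩
  H 0 0 (suc a) + splitSum a (λ s l → H 0 (suc s) l + splitSum s (λ x m → H (suc x) m l))
    ∎
  where open ≡-Reasoning

splitSum-exchange : ∀ a (H : ℕ → ℕ → ℕ → ℕ) →
  splitSum a (λ y s → splitSum s (λ s' l' → H y s' l')) ≡ splitSum a (λ m s' → splitSum m (λ y l' → H y s' l'))
splitSum-exchange a H = begin
  splitSum a (λ y s → splitSum s (λ s' l' → H y s' l'))
    ≡⟨ splitSum-assoc a H ⟩
  splitSum a (λ t l' → splitSum t (λ y s' → H y s' l'))
    ≡⟨ splitSum-cong a (λ t l' → splitSum-swap t (λ y s' → H y s' l')) ⟩
  splitSum a (λ t l' → splitSum t (λ s' y → H y s' l'))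
    ≡⟨ sym (splitSum-assoc a (λ s' y l' → H y s' l')) ⟩
  splitSum a (λ s' r → splitSum r (λ y l' → H y s' l'))
    ≡⟨ splitSum-swap a _ ⟩
  splitSum a (λ m s' → splitSum m (λ y l' → H y s' l'))
    ∎
  where open ≡-Reasoning

-- Σ_{x + r = a} Σ_{s + l = r} J s = Σ_{y + s = a} (1 + y) J s : each s is counted
-- once for every y ≤ a - s.
splitSum-triangle : ∀ a (J : ℕ → ℕ) →
  splitSum a (λ _ r → splitSum r (λ s _ → J s)) ≡ splitSum a (λ y s → suc y * J s)
splitSum-triangle zero    J = sym (+-identityʳ (J 0))
splitSum-triangle (suc a) J = begin
  splitSum (suc a) (λ s _ → J s) + splitSum a (λ _ r → splitSum r (λ s _ → J s))
    ≡⟨ cong₂ _+_ diagonal (splitSum-triangle a J) ⟩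
  (J (suc a) + splitSum a (λ _ s → J s)) + splitSum a (λ y s → suc y * J s)
    ≡⟨ +-assoc (J (suc a)) _ _ ⟩
  J (suc a) + (splitSum a (λ _ s → J s) + splitSum a (λ y s → suc y * J s))
    ≡⟨ cong₂ _+_ (sym (*-identityˡ (J (suc a)))) (sym (splitSum-+ a _ _)) ⟩
  1 * J (suc a) + splitSum a (λ y s → suc (suc y) * J s)
    ∎
  where
  open ≡-Reasoning
  diagonal : splitSum (suc a) (λ s _ → J s) ≡ J (suc a) + splitSum a (λ _ s → J s)
  diagonal = trans (splitSum-last a (λ s _ → J s)) (cong (J (suc a) +_) (splitSum-swap a (λ s _ → J s)))

-- Σ_{v ∈ ℕ^p, Σ v = a} F v : a sum over the weak compositions of a into p parts.
compSum : ℕ → (p : ℕ) → (Vec ℕ p → ℕ) → ℕ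
compSum a (suc p) F = splitSum a (λ x r → compSum r p (λ v → F (x ∷ v)))
compSum zero    zero F = F []
compSum (suc a) zero F = 0

compSum-cong : ∀ a p {F G : Vec ℕ p → ℕ} → (∀ v → F v ≡ G v) → compSum a p F ≡ compSum a p G
compSum-cong a       (suc p) F≡G = splitSum-cong a (λ x r → compSum-cong r p (λ v → F≡G (x ∷ v)))
compSum-cong zero    zero    F≡G = F≡G []
compSum-cong (suc a) zero    F≡G = refl

compSum-mono : ∀ a p {F G : Vec ℕ p → ℕ} →
  (∀ v → Vec.sum v ≡ a → F v ≤ G v) → compSum a p F ≤ compSum a p G
compSum-mono a (suc p) F≤G = splitSum-mono a (λ x r x+r≡a →
  compSum-mono r p (λ v Σv≡r → F≤G (x ∷ v) (trans (cong (x +_) Σv≡r) x+r≡a)))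
compSum-mono zero    zero F≤G = F≤G [] refl
compSum-mono (suc a) zero F≤G = ≤-refl

compSum-+ : ∀ a p (F G : Vec ℕ p → ℕ) → compSum a p (λ v → F v + G v) ≡ compSum a p F + compSum a p G
compSum-+ a       (suc p) F G = trans (splitSum-cong a (λ x r → compSum-+ r p _ _)) (splitSum-+ a _ _)
compSum-+ zero    zero    F G = refl
compSum-+ (suc a) zero    F G = refl

compSum-* : ∀ a p m (F : Vec ℕ p → ℕ) → compSum a p (λ v → m * F v) ≡ m * compSum a p F
compSum-* a       (suc p) m F = trans (splitSum-cong a (λ x r → compSum-* r p m _)) (splitSum-* a m _)
compSum-* zero    zero    m F = refl
compSum-* (suc a) zero    m F = sym (*-zeroʳ m)

compSum-zero : ∀ p (F : Vec ℕ p → ℕ) → compSum 0 p F ≡ F (replicate p 0)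
compSum-zero zero    F = refl
compSum-zero (suc p) F = compSum-zero p (λ v → F (0 ∷ v))

compSum-∷ʳ : ∀ a p (F : Vec ℕ (suc p) → ℕ) →
  compSum a (suc p) F ≡ splitSum a (λ s l → compSum s p (λ v → F (v ∷ʳ l)))
compSum-∷ʳ a zero    F = trans (splitSum-swap a _) (splitSum-cong a single)
  where
  single : ∀ u l → compSum u 0 (λ v → F (l ∷ v)) ≡ compSum u 0 (λ v → F (v ∷ʳ l))
  single zero    l = refl
  single (suc u) l = refl
compSum-∷ʳ a (suc p) F =
  trans (splitSum-cong a (λ x r → compSum-∷ʳ r p (λ v → F (x ∷ v))))
        (splitSum-assoc a (λ x m l → compSum m p (λ v → F (x ∷ (v ∷ʳ l)))))

_⊕_ : ∀ {n} → Vec ℕ n → Vec ℕ n → Vec ℕ n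
_⊕_ = zipWith _+_

sum-⊕ : ∀ {n} (g v : Vec ℕ n) → Vec.sum (g ⊕ v) ≡ Vec.sum g + Vec.sum v
sum-⊕ []      []      = refl
sum-⊕ (x ∷ g) (y ∷ v) =
  trans (cong (x + y +_) (sum-⊕ g v)) (interchange x y (Vec.sum g) (Vec.sum v))

sum-∷ʳ : ∀ {n} (g : Vec ℕ n) x → Vec.sum (g ∷ʳ x) ≡ Vec.sum g + x
sum-∷ʳ []      x = +-identityʳ x
sum-∷ʳ (y ∷ g) x = trans (cong (y +_) (sum-∷ʳ g x)) (sym (+-assoc y _ x))

⊕-∷ʳ : ∀ {n} (g v : Vec ℕ n) x y → (g ∷ʳ x) ⊕ (v ∷ʳ y) ≡ (g ⊕ v) ∷ʳ (x + y)
⊕-∷ʳ []      []      x y = refl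
⊕-∷ʳ (a ∷ g) (b ∷ v) x y = cong (a + b ∷_) (⊕-∷ʳ g v x y)

spread : ∀ {n} → ℕ → (Vec ℕ n → ℕ) → Vec ℕ n → ℕ
spread {n} r F g = compSum r n (λ v → F (g ⊕ v))

sum-⊕-comp : ∀ {n} (g v : Vec ℕ n) {r} → Vec.sum v ≡ r → Vec.sum (g ⊕ v) ≡ Vec.sum g + r
sum-⊕-comp g v Σv≡r = trans (sum-⊕ g v) (cong (Vec.sum g +_) Σv≡r)

spread-∷ʳ : ∀ {n} r (F : Vec ℕ (suc n) → ℕ) (g : Vec ℕ n) x →
  spread r F (g ∷ʳ x) ≡ splitSum r (λ s l → spread s (λ h → F (h ∷ʳ (x + l))) g)
spread-∷ʳ {n} r F g x = trans (compSum-∷ʳ r n (λ v → F ((g ∷ʳ x) ⊕ v)))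
  (splitSum-cong r (λ s l → compSum-cong s n (λ v → cong F (⊕-∷ʳ g v x l))))

-- count g is the number of upper-triangular matrices with hook vector g (see
-- hookMatrices-length).  The first row (c₀ ∷ v) of such a matrix has c₀ + Σ v = g₀,
-- and deleting it leaves a matrix with hook vector (tail g) ⊕ v.
count : ∀ {n} → Vec ℕ n → ℕ
count []      = 1
count (a ∷ g) = splitSum a (λ _ r → spread r count g)

count₁ : ∀ {n} → Vec ℕ n → ℕ
count₁ g = count (g ∷ʳ 0)

count₂ : ∀ {n} → Vec ℕ n → ℕ
count₂ g = count₁ (g ∷ʳ 0)

count-positive : ∀ {n} (g : Vec ℕ n) → 1 ≤ count g
count-positive []              = ≤-refl
count-positive {suc n} (a ∷ g) = begin
  1                                    ≤⟨ count-positive (g ⊕ replicate n 0) ⟩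
  count (g ⊕ replicate n 0)            ≡⟨ compSum-zero n (λ v → count (g ⊕ v)) ⟨
  spread 0 count g                     ≤⟨ splitSum-lastTerm a (λ _ r → spread r count g) ⟩
  count (a ∷ g)                        ∎
  where open ≤-Reasoning

-- The last hook does not matter: the last row consists of its diagonal entry only,
-- which is determined by the column above it.
count-lastHook : ∀ {n} (g : Vec ℕ n) x y → count (g ∷ʳ x) ≡ count (g ∷ʳ y)
count-lastHook []      x y = trans (single x) (sym (single y))
  where
  single : ∀ a → count (a ∷ []) ≡ 1
  single zero    = refl
  single (suc a) = single a
count-lastHook (a ∷ g) x y = splitSum-cong a (λ _ r → begin
  spread r count (g ∷ʳ x)
    ≡⟨ spread-∷ʳ r count g x ⟩
  splitSum r (λ s l → spread s (λ h → count (h ∷ʳ (x + l))) g)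
    ≡⟨ splitSum-cong r (λ s l → compSum-cong s _ (λ v → count-lastHook (g ⊕ v) (x + l) (y + l))) ⟩
  splitSum r (λ s l → spread s (λ h → count (h ∷ʳ (y + l))) g)
    ≡⟨ spread-∷ʳ r count g y ⟨
  spread r count (g ∷ʳ y)
    ∎)
  where open ≡-Reasoning

-- Recursion for count₁: the first row distributes its off-diagonal mass between the
-- new last column (l) and the remaining columns (s).
count₁-cons : ∀ {n} a (g : Vec ℕ n) →
  count₁ (a ∷ g) ≡ splitSum a (λ y s → suc y * spread s count₁ g)
count₁-cons a g = begin
  splitSum a (λ _ r → spread r count (g ∷ʳ 0))
    ≡⟨ splitSum-cong a (λ _ r → trans (spread-∷ʳ r count g 0) (splitSum-cong r lastZero)) ⟩
  splitSum a (λ _ r → splitSum r (λ s _ → spread s count₁ g))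
    ≡⟨ splitSum-triangle a (λ s → spread s count₁ g) ⟩
  splitSum a (λ y s → suc y * spread s count₁ g)
    ∎
  where
  open ≡-Reasoning
  lastZero : ∀ s l → spread s (λ h → count (h ∷ʳ l)) g ≡ spread s count₁ g
  lastZero s l = compSum-cong s _ (λ v → count-lastHook (g ⊕ v) l 0)

-- The weight 1 + a + Σ g of a term with x + r = a is at most the product of the weight
-- 1 + x of the new column and the weight 1 + Σ g + r of the remaining hooks.
private
  weight-split : ∀ x r S → suc (x + r + S) ≤ suc x * suc (S + r)
  weight-split x r S = ≤-trans (m≤m+n _ (x * (S + r))) (≤-reflexive (identity x r S))
    where
    identity : ∀ x r S → suc (x + r + S) + x * (S + r) ≡ suc x * suc (S + r)
    identity = solve-∀

count-growth : ∀ {n} (g : Vec ℕ n) → suc (Vec.sum g) * count g ≤ count₁ g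
count-growth []      = ≤-refl
count-growth {suc n} (a ∷ g) = begin
  suc (a + S) * splitSum a (λ _ r → spread r count g)
    ≡⟨ splitSum-* a (suc (a + S)) _ ⟨
  splitSum a (λ _ r → suc (a + S) * spread r count g)
    ≤⟨ splitSum-mono a termwise ⟩
  splitSum a (λ y s → suc y * spread s count₁ g)
    ≡⟨ count₁-cons a g ⟨
  count₁ (a ∷ g)
    ∎
  where
  open ≤-Reasoning
  S = Vec.sum g
  spread-growth : ∀ r → suc (S + r) * spread r count g ≤ spread r count₁ g
  spread-growth r = begin
    suc (S + r) * spread r count g
      ≡⟨ compSum-* r n (suc (S + r)) _ ⟨
    spread r (λ h → suc (S + r) * count h) g
      ≤⟨ compSum-mono r n (λ v Σv≡r →
           subst (λ z → suc z * count (g ⊕ v) ≤ count₁ (g ⊕ v))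
                 (sum-⊕-comp g v Σv≡r) (count-growth (g ⊕ v))) ⟩
    spread r count₁ g
      ∎
  termwise : ∀ x r → x + r ≡ a → suc (a + S) * spread r count g ≤ suc x * spread r count₁ g
  termwise x r refl = begin
    suc (x + r + S) * spread r count g
      ≤⟨ *-monoˡ-≤ (spread r count g) (weight-split x r S) ⟩
    (suc x * suc (S + r)) * spread r count g
      ≡⟨ *-assoc (suc x) (suc (S + r)) _ ⟩
    suc x * (suc (S + r) * spread r count g)
      ≤⟨ *-monoʳ-≤ (suc x) (spread-growth r) ⟩
    suc x * spread r count₁ g
      ∎

count≤count₁ : ∀ {n} (g : Vec ℕ n) → count g ≤ count₁ g
count≤count₁ g = ≤-trans (m≤m+n (count g) (Vec.sum g * count g)) (count-growth g)

splitSum-linear-bound : ∀ q m → suc m * suc q + m ≤ splitSum m (λ _ l → suc (q + l))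
splitSum-linear-bound q zero    = ≤-reflexive (base q)
  where
  base : ∀ q → 1 * suc q + 0 ≡ suc (q + 0)
  base = solve-∀
splitSum-linear-bound q (suc m) = begin
  suc (suc m) * suc q + suc m
    ≤⟨ m≤m+n _ m ⟩
  suc (suc m) * suc q + suc m + m
    ≡⟨ regroup q m ⟩
  suc (q + suc m) + (suc m * suc q + m)
    ≤⟨ +-monoʳ-≤ (suc (q + suc m)) (splitSum-linear-bound q m) ⟩
  suc (q + suc m) + splitSum m (λ _ l → suc (q + l))
    ∎
  where
  open ≤-Reasoning
  regroup : ∀ q m → suc (suc m) * suc q + suc m + m ≡ suc (q + suc m) + (suc m * suc q + m)
  regroup = solve-∀

weightedSum-unfold : ∀ q m →
  splitSum (suc m) (λ y l → suc y * suc (q + l))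
    ≡ suc (q + suc m) + (splitSum m (λ _ l → suc (q + l)) + splitSum m (λ y l → suc y * suc (q + l)))
weightedSum-unfold q m = cong₂ _+_ (+-identityʳ _) (splitSum-+ m _ _)

weightedSum-bound : ∀ q m →
  suc (suc m) * suc (suc m + q) + (suc m * q + m) ≤ splitSum (suc m) (λ y l → suc y * suc (q + l))
weightedSum-bound q zero    = ≤-reflexive (base q)
  where
  base : ∀ q → 2 * suc (1 + q) + (1 * q + 0) ≡ 1 * suc (q + 1) + 2 * suc (q + 0)
  base = solve-∀
weightedSum-bound q (suc m) = begin
  suc (suc (suc m)) * suc (suc (suc m) + q) + (suc (suc m) * q + suc m)
    ≤⟨ m≤m+n _ (m + m * q + q) ⟩
  suc (suc (suc m)) * suc (suc (suc m) + q) + (suc (suc m) * q + suc m) + (m + m * q + q)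
    ≡⟨ regroup q m ⟩
  suc (q + suc (suc m)) + ((suc (suc m) * suc q + suc m) + (suc (suc m) * suc (suc m + q) + (suc m * q + m)))
    ≤⟨ +-monoʳ-≤ (suc (q + suc (suc m))) (+-mono-≤ (splitSum-linear-bound q (suc m)) (weightedSum-bound q m)) ⟩
  suc (q + suc (suc m)) + (splitSum (suc m) (λ _ l → suc (q + l)) + splitSum (suc m) (λ y l → suc y * suc (q + l)))
    ≡⟨ weightedSum-unfold q (suc m) ⟨
  splitSum (suc (suc m)) (λ y l → suc y * suc (q + l))
    ∎
  where
  open ≤-Reasoning
  regroup : ∀ q m →
    suc (suc (suc m)) * suc (suc (suc m) + q) + (suc (suc m) * q + suc m) + (m + m * q + q)
      ≡ suc (q + suc (suc m)) + ((suc (suc m) * suc q + suc m) + (suc (suc m) * suc (suc m + q) + (suc m * q + m)))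
  regroup = solve-∀

weightedSum-strict : ∀ q m → 1 ≤ q ⊎ 1 ≤ m →
  suc (suc m + q) * suc (suc m) + 1 ≤ splitSum (suc m) (λ y l → suc y * suc (q + l))
weightedSum-strict q m q+m≥1 = begin
  suc (suc m + q) * suc (suc m) + 1
    ≡⟨ cong (_+ 1) (*-comm (suc (suc m + q)) (suc (suc m))) ⟩
  suc (suc m) * suc (suc m + q) + 1
    ≤⟨ +-monoʳ-≤ _ (positive q+m≥1) ⟩
  suc (suc m) * suc (suc m + q) + (suc m * q + m)
    ≤⟨ weightedSum-bound q m ⟩
  splitSum (suc m) (λ y l → suc y * suc (q + l))
    ∎
  where
  open ≤-Reasoning
  positive : 1 ≤ q ⊎ 1 ≤ m → 1 ≤ suc m * q + m
  positive (inj₁ 1≤q) = ≤-trans 1≤q (≤-trans (m≤m+n q (m * q)) (m≤m+n _ m))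
  positive (inj₂ 1≤m) = ≤-trans 1≤m (m≤n+m m _)

count₂-growth : ∀ {n} (g : Vec ℕ n) → 2 ≤ Vec.sum g →
  suc (Vec.sum g) * count₁ g + count g ≤ count₂ g
count₂-growth []              ()
count₂-growth {suc n} (a ∷ g) 2≤S = begin
  suc S * count₁ (a ∷ g) + count (a ∷ g)
    ≡⟨ cong (λ z → suc S * z + count (a ∷ g)) (count₁-cons a g) ⟩
  suc S * splitSum a (λ y s → suc y * W s) + splitSum a (λ _ r → C r)
    ≡⟨ cong (_+ splitSum a (λ _ r → C r)) (splitSum-* a (suc S) _) ⟨
  splitSum a (λ y s → suc S * (suc y * W s)) + splitSum a (λ _ r → C r)
    ≡⟨ splitSum-+ a _ _ ⟨
  splitSum a (λ m s → suc S * (suc m * W s) + C s)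
    ≤⟨ splitSum-mono a termwise ⟩
  splitSum a (λ m s → splitSum m (λ y l → suc y * X s l))
    ≡⟨ count₂-cons ⟨
  count₂ (a ∷ g)
    ∎
  where
  open ≤-Reasoning
  S′ = Vec.sum g
  S  = a + S′
  C W : ℕ → ℕ
  C r = spread r count g
  W s = spread s count₁ g
  -- X s l : the first row puts s into the old columns and l into the first new column.
  X : ℕ → ℕ → ℕ
  X s l = spread s (λ h → count₁ (h ∷ʳ l)) g

  count₂-cons : count₂ (a ∷ g) ≡ splitSum a (λ m s → splitSum m (λ y l → suc y * X s l))
  count₂-cons = begin-equality
    count₁ (a ∷ (g ∷ʳ 0))
      ≡⟨ count₁-cons a (g ∷ʳ 0) ⟩
    splitSum a (λ y r → suc y * spread r count₁ (g ∷ʳ 0))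
      ≡⟨ splitSum-cong a (λ y r → cong (suc y *_) (spread-∷ʳ r count₁ g 0)) ⟩
    splitSum a (λ y r → suc y * splitSum r X)
      ≡⟨ splitSum-cong a (λ y r → splitSum-* r (suc y) X) ⟨
    splitSum a (λ y r → splitSum r (λ s l → suc y * X s l))
      ≡⟨ splitSum-exchange a (λ y s l → suc y * X s l) ⟩
    splitSum a (λ m s → splitSum m (λ y l → suc y * X s l))
      ∎

  X-growth : ∀ s l → suc (S′ + s + l) * W s ≤ X s l
  X-growth s l = begin
    suc (S′ + s + l) * W s
      ≡⟨ compSum-* s n (suc (S′ + s + l)) _ ⟨
    spread s (λ h → suc (S′ + s + l) * count₁ h) g
      ≤⟨ compSum-mono s n (λ v Σv≡s →
           subst₂ (λ z w → suc z * w ≤ count₁ ((g ⊕ v) ∷ʳ l))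
                  (trans (sum-∷ʳ (g ⊕ v) l) (cong (_+ l) (sum-⊕-comp g v Σv≡s)))
                  (count-lastHook (g ⊕ v) l 0)
                  (count-growth ((g ⊕ v) ∷ʳ l))) ⟩
    X s l
      ∎

  X-zero : ∀ s → 2 ≤ S′ + s → suc (S′ + s) * W s + C s ≤ X s 0
  X-zero s 2≤S′+s = begin
    suc (S′ + s) * W s + C s
      ≡⟨ cong (_+ C s) (compSum-* s n (suc (S′ + s)) _) ⟨
    spread s (λ h → suc (S′ + s) * count₁ h) g + C s
      ≡⟨ compSum-+ s n _ _ ⟨
    spread s (λ h → suc (S′ + s) * count₁ h + count h) g
      ≤⟨ compSum-mono s n (λ v Σv≡s →
           subst (λ z → suc z * count₁ (g ⊕ v) + count (g ⊕ v) ≤ count₂ (g ⊕ v))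
                 (sum-⊕-comp g v Σv≡s)
                 (count₂-growth (g ⊕ v) (subst (2 ≤_) (sym (sum-⊕-comp g v Σv≡s)) 2≤S′+s))) ⟩
    X s 0
      ∎

  termwise : ∀ m s → m + s ≡ a → suc S * (suc m * W s) + C s ≤ splitSum m (λ y l → suc y * X s l)
  termwise zero s refl = begin
    suc (s + S′) * (1 * W s) + C s
      ≡⟨ cong₂ (λ z w → suc z * w + C s) (+-comm s S′) (*-identityˡ (W s)) ⟩
    suc (S′ + s) * W s + C s
      ≤⟨ X-zero s (subst (2 ≤_) (+-comm s S′) 2≤S) ⟩
    X s 0
      ≡⟨ *-identityˡ (X s 0) ⟨
    1 * X s 0
      ∎
  termwise (suc m) s refl = begin
    suc S * (suc (suc m) * W s) + C s
      ≤⟨ +-monoʳ-≤ _ (compSum-mono s n (λ v _ → count≤count₁ (g ⊕ v))) ⟩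
    suc S * (suc (suc m) * W s) + W s
      ≡⟨ collect S (suc (suc m)) (W s) ⟩
    (suc S * suc (suc m) + 1) * W s
      ≡⟨ cong (λ z → (suc z * suc (suc m) + 1) * W s) (+-assoc (suc m) s S′) ⟩
    (suc (suc m + q) * suc (suc m) + 1) * W s
      ≤⟨ *-monoˡ-≤ (W s) (weightedSum-strict q m q+m≥1) ⟩
    splitSum (suc m) (λ y l → suc y * suc (q + l)) * W s
      ≡⟨ splitSum-*ʳ (suc m) (W s) (λ y l → suc y * suc (q + l)) ⟨
    splitSum (suc m) (λ y l → suc y * suc (q + l) * W s)
      ≤⟨ splitSum-mono (suc m) (λ y l _ → weighted y l) ⟩
    splitSum (suc m) (λ y l → suc y * X s l)
      ∎
    where
    q = s + S′
    X-growth′ : ∀ l → suc (q + l) * W s ≤ X s l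
    X-growth′ l = subst (λ z → suc (z + l) * W s ≤ X s l) (+-comm S′ s) (X-growth s l)
    weighted : ∀ y l → suc y * suc (q + l) * W s ≤ suc y * X s l
    weighted y l = ≤-trans (≤-reflexive (*-assoc (suc y) (suc (q + l)) (W s)))
                           (*-monoʳ-≤ (suc y) (X-growth′ l))
    collect : ∀ A B w → suc A * (B * w) + w ≡ (suc A * B + 1) * w
    collect = solve-∀
    q+m≥1 : 1 ≤ q ⊎ 1 ≤ m
    q+m≥1 = positive m (subst (2 ≤_) (+-assoc (suc m) s S′) 2≤S)
      where
      positive : ∀ m → 2 ≤ suc m + q → 1 ≤ q ⊎ 1 ≤ m
      positive zero    2≤1+q = inj₁ (≤-pred 2≤1+q)
      positive (suc _) _     = inj₂ (s≤s z≤n)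

module SequenceGrowth (K k : ℕ) (t : ℕ → ℕ) (t-start : 1 ≤ t k)
                      (step₁ : ∀ n → k ≤ n → K * t n ≤ t (suc n)) where

  geometric : ∀ d → K ^ d ≤ t (k + d)
  geometric zero    = subst (λ i → 1 ≤ t i) (sym (+-identityʳ k)) t-start
  geometric (suc d) = begin
    K * K ^ d        ≤⟨ *-monoʳ-≤ K (geometric d) ⟩
    K * t (k + d)    ≤⟨ step₁ (k + d) (m≤m+n k d) ⟩
    t (suc (k + d))  ≡⟨ cong t (+-suc k d) ⟨
    t (k + suc d)    ∎
    where open ≤-Reasoning

  -- With the second-order law t (n + 2) ≥ K t (n + 1) + t n the excess over K ^ d
  -- accumulates linearly: t (k + 1 + d) ≥ K ^ (d + 1) + d K ^ (d - 1).
  module SecondOrder (step₂ : ∀ n → k ≤ n → K * t (suc n) + t n ≤ t (suc (suc n))) where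

    accumulated : ∀ d → (K * K + d) * K ^ d ≤ K * t (k + suc d)
    accumulated zero = begin
      (K * K + 0) * 1  ≡⟨ base K ⟩
      K * K ^ 1        ≤⟨ *-monoʳ-≤ K (geometric 1) ⟩
      K * t (k + 1)    ∎
      where
      open ≤-Reasoning
      base : ∀ K → (K * K + 0) * 1 ≡ K * (K * 1)
      base = solve-∀
    accumulated (suc d) = begin
      (K * K + suc d) * (K * K ^ d)
        ≡⟨ expand K d (K ^ d) ⟩
      K * ((K * K + d) * K ^ d) + K * K ^ d
        ≤⟨ +-mono-≤ (*-monoʳ-≤ K (accumulated d)) (*-monoʳ-≤ K (geometric d)) ⟩
      K * (K * t (k + suc d)) + K * t (k + d)
        ≡⟨ *-distribˡ-+ K _ _ ⟨
      K * (K * t (k + suc d) + t (k + d))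
        ≡⟨ cong (λ i → K * (K * t i + t (k + d))) (+-suc k d) ⟩
      K * (K * t (suc (k + d)) + t (k + d))
        ≤⟨ *-monoʳ-≤ K (step₂ (k + d) (m≤m+n k d)) ⟩
      K * t (suc (suc (k + d)))
        ≡⟨ cong (λ i → K * t (suc i)) (+-suc k d) ⟨
      K * t (suc (k + suc d))
        ≡⟨ cong (λ i → K * t i) (+-suc k (suc d)) ⟨
      K * t (k + suc (suc d))
        ∎
      where
      open ≤-Reasoning
      expand : ∀ K d P → (K * K + suc d) * (K * P) ≡ K * ((K * K + d) * P) + K * P
      expand = solve-∀

    -- Once d ≥ K ^ (k + 1), the linear excess beats the missing factor K ^ k.
    eventually : .{{_ : NonZero K}} → ∀ d → K ^ suc k ≤ d → K ^ (k + d) ≤ t (k + suc d)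
    eventually d K^[k+1]≤d = *-cancelˡ-≤ K (begin
      K * K ^ (k + d)         ≡⟨ ^-distribˡ-+-* K (suc k) d ⟩
      K ^ suc k * K ^ d       ≤⟨ *-monoˡ-≤ (K ^ d) K^[k+1]≤d ⟩
      d * K ^ d               ≤⟨ *-monoˡ-≤ (K ^ d) (m≤n+m d (K * K)) ⟩
      (K * K + d) * K ^ d     ≤⟨ accumulated d ⟩
      K * t (k + suc d)       ∎)
      where open ≤-Reasoning

sum-concatMap : ∀ {A B : Set} (F : B → ℕ) (h : A → List B) (xs : List A) →
  sum (map F (concatMap h xs)) ≡ sum (map (λ x → sum (map F (h x))) xs)
sum-concatMap F h []       = refl
sum-concatMap F h (x ∷ xs) = begin
  sum (map F (h x ++ concatMap h xs))
    ≡⟨ cong sum (map-++ F (h x) _) ⟩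
  sum (map F (h x) ++ map F (concatMap h xs))
    ≡⟨ sum-++ (map F (h x)) _ ⟩
  sum (map F (h x)) + sum (map F (concatMap h xs))
    ≡⟨ cong (sum (map F (h x)) +_) (sum-concatMap F h xs) ⟩
  sum (map F (h x)) + sum (map (λ x → sum (map F (h x))) xs)
    ∎
  where open ≡-Reasoning

length-concatMap : ∀ {A B : Set} (h : A → List B) (xs : List A) →
  length (concatMap h xs) ≡ sum (map (λ x → length (h x)) xs)
length-concatMap h []       = refl
length-concatMap h (x ∷ xs) = trans (length-++ (h x)) (cong (length (h x) +_) (length-concatMap h xs))

concatMap-unique : ∀ {A B : Set} (h : A → List B) (key : B → A) {xs : List A} → Unique xs →
  (∀ x → Unique (h x)) → (∀ {x y} → y ∈ h x → key y ≡ x) → Unique (concatMap h xs)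
concatMap-unique h key []                  _        _     = []
concatMap-unique h key {x ∷ xs} (x∉xs ∷ u) unique-h key-h =
  Unique.++⁺ (unique-h x) (concatMap-unique h key u unique-h key-h) disjoint
  where
  disjoint : ∀ {y} → ¬ (y ∈ h x × y ∈ concatMap h xs)
  disjoint {y} (y∈hx , y∈rest) = apart x∉xs (∈-concatMap⁻ h {xs = xs} y∈rest)
    where
    apart : ∀ {zs} → All (λ z → ¬ x ≡ z) zs → Any (λ z → y ∈ h z) zs → ⊥
    apart (x≢z ∷ _)    (here y∈hz) = x≢z (trans (sym (key-h y∈hx)) (key-h y∈hz))
    apart (_   ∷ x≢zs) (there y∈) = apart x≢zs y∈

splits : ℕ → List (ℕ × ℕ)
splits zero    = [ (0 , 0) ]
splits (suc a) = (0 , suc a) ∷ map (Product.map₁ suc) (splits a)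

sum-splits : ∀ a (H : ℕ × ℕ → ℕ) → sum (map H (splits a)) ≡ splitSum a (λ u l → H (u , l))
sum-splits zero    H = +-identityʳ (H (0 , 0))
sum-splits (suc a) H = cong (H (0 , suc a) +_)
  (trans (cong sum (sym (map-∘ (splits a)))) (sum-splits a (λ p → H (Product.map₁ suc p))))

splits-sound : ∀ a {u l} → (u , l) ∈ splits a → u + l ≡ a
splits-sound zero    (here refl) = refl
splits-sound (suc a) (here refl) = refl
splits-sound (suc a) (there p∈) with ∈-map⁻ (Product.map₁ suc) p∈
... | _ , p∈′ , refl = cong suc (splits-sound a p∈′)

splits-complete : ∀ a u l → u + l ≡ a → (u , l) ∈ splits a
splits-complete zero    zero    zero refl = here refl
splits-complete (suc a) zero    l    refl = here refl
splits-complete (suc a) (suc u) l    eq   =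
  there (∈-map⁺ (Product.map₁ suc) (splits-complete a u l (suc-injective eq)))

splits-unique : ∀ a → Unique (splits a)
splits-unique zero    = [] ∷ []
splits-unique (suc a) = All.tabulate first-distinct ∷ Unique.map⁺ shift-injective (splits-unique a)
  where
  shift-injective : ∀ {p q : ℕ × ℕ} → Product.map₁ suc p ≡ Product.map₁ suc q → p ≡ q
  shift-injective {_ , _} {_ , _} refl = refl
  first-distinct : ∀ {p} → p ∈ map (Product.map₁ suc) (splits a) → ¬ (0 , suc a) ≡ p
  first-distinct p∈ refl with ∈-map⁻ (Product.map₁ suc) p∈
  ... | _ , _ , ()

comps : ℕ → (p : ℕ) → List (Vec ℕ p)
withFirst : ∀ p → ℕ × ℕ → List (Vec ℕ (suc p))

comps a       (suc p) = concatMap (withFirst p) (splits a)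
comps zero    zero    = [ [] ]
comps (suc a) zero    = []

withFirst p (x , r) = map (x ∷_) (comps r p)

sum-comps : ∀ a p (F : Vec ℕ p → ℕ) → sum (map F (comps a p)) ≡ compSum a p F
sum-comps a (suc p) F = begin
  sum (map F (concatMap (withFirst p) (splits a)))
    ≡⟨ sum-concatMap F (withFirst p) (splits a) ⟩
  sum (map (λ xr → sum (map F (withFirst p xr))) (splits a))
    ≡⟨ cong sum (map-cong block (splits a)) ⟩
  sum (map (λ xr → compSum (proj₂ xr) p (λ v → F (proj₁ xr ∷ v))) (splits a))
    ≡⟨ sum-splits a _ ⟩
  compSum a (suc p) F
    ∎
  where
  open ≡-Reasoning
  block : ∀ xr → sum (map F (withFirst p xr)) ≡ compSum (proj₂ xr) p (λ v → F (proj₁ xr ∷ v))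
  block (x , r) = trans (cong sum (sym (map-∘ (comps r p)))) (sum-comps r p (λ v → F (x ∷ v)))
sum-comps zero    zero F = +-identityʳ (F [])
sum-comps (suc a) zero F = refl

comps-sound : ∀ a p {v} → v ∈ comps a p → Vec.sum v ≡ a
comps-sound a (suc p) v∈ with find (∈-concatMap⁻ (withFirst p) {xs = splits a} v∈)
... | (x , r) , xr∈ , v∈block with ∈-map⁻ (x ∷_) v∈block
... | w , w∈ , refl = trans (cong (x +_) (comps-sound r p w∈)) (splits-sound a xr∈)
comps-sound zero zero (here refl) = refl

comps-complete : ∀ a p (v : Vec ℕ p) → Vec.sum v ≡ a → v ∈ comps a p
comps-complete a (suc p) (x ∷ w) Σ≡a = ∈-concatMap⁺ (withFirst p) {xs = splits a}
  (lose (splits-complete a x (Vec.sum w) Σ≡a) (∈-map⁺ (x ∷_) (comps-complete (Vec.sum w) p w refl)))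
comps-complete zero zero [] refl = here refl

comps-unique : ∀ a p → Unique (comps a p)
comps-unique a (suc p) = concatMap-unique (withFirst p) key (splits-unique a)
  (λ (x , r) → Unique.map⁺ Vec.∷-injectiveʳ (comps-unique r p)) key-withFirst
  where
  key : Vec ℕ (suc p) → ℕ × ℕ
  key (x ∷ w) = x , Vec.sum w
  key-withFirst : ∀ {xr v} → v ∈ withFirst p xr → key v ≡ xr
  key-withFirst {x , r} v∈ with ∈-map⁻ (x ∷_) v∈
  ... | w , w∈ , refl = cong (x ,_) (comps-sound r p w∈)
comps-unique zero    zero = [] ∷ []
comps-unique (suc a) zero = []

maskedSum : ∀ n → (Fin n → Bool) → (Fin n → ℕ) → ℕ
maskedSum zero    p F = 0
maskedSum (suc n) p F = (if p zero then F zero else 0) + maskedSum n (λ i → p (suc i)) (λ i → F (suc i))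

maskedSum-cong : ∀ n {p p′ : Fin n → Bool} {F F′ : Fin n → ℕ} →
  (∀ i → p i ≡ p′ i) → (∀ i → F i ≡ F′ i) → maskedSum n p F ≡ maskedSum n p′ F′
maskedSum-cong zero    p≡ F≡ = refl
maskedSum-cong (suc n) p≡ F≡ = cong₂ _+_ (cong₂ (λ b x → if b then x else 0) (p≡ zero) (F≡ zero))
                                         (maskedSum-cong n (λ i → p≡ (suc i)) (λ i → F≡ (suc i)))

maskedSum-all : ∀ {n} (c : Vec ℕ n) → maskedSum n (λ _ → true) (Vec.lookup c) ≡ Vec.sum c
maskedSum-all []      = refl
maskedSum-all (x ∷ c) = cong (x +_) (maskedSum-all c)

maskedSum-none : ∀ n (F : Fin n → ℕ) → maskedSum n (λ _ → false) F ≡ 0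
maskedSum-none zero    F = refl
maskedSum-none (suc n) F = maskedSum-none n (λ i → F (suc i))

sum-filter-tabulate : ∀ {m} n {P : Pred (Fin m) 0ℓ} (P? : Decidable P) (f : Fin n → Fin m) (F : Fin m → ℕ) →
  sum (map F (filter P? (tabulate f))) ≡ maskedSum n (λ i → does (P? (f i))) (λ i → F (f i))
sum-filter-tabulate zero    P? f F = refl
sum-filter-tabulate (suc n) P? f F with does (P? (f zero))
... | true  = cong (F (f zero) +_) (sum-filter-tabulate n P? (λ i → f (suc i)) F)
... | false = sum-filter-tabulate n P? (λ i → f (suc i)) F

rowTail-masked : ∀ {n} (A : Mat n) j → rowTail A j ≡ maskedSum n (λ l → does (j Fin.≤? l)) (entry A j)
rowTail-masked {n} A j = sum-filter-tabulate n (j Fin.≤?_) (λ i → i) (entry A j)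

colAbove-masked : ∀ {n} (A : Mat n) j → colAbove A j ≡ maskedSum n (λ i → does (i Fin.<? j)) (λ i → entry A i j)
colAbove-masked {n} A j = sum-filter-tabulate n (Fin._<? j) (λ i → i) (λ i → entry A i j)

consM : ∀ {n} → Vec ℕ (suc n) → Mat n → Mat (suc n)
consM c B = c ∷ Vec.map (0 ∷_) B

entry-consM-below : ∀ {n} (c : Vec ℕ (suc n)) B i → entry (consM c B) (suc i) zero ≡ 0
entry-consM-below c B i = cong (λ r → Vec.lookup r zero) (Vec.lookup-map i (0 ∷_) B)

entry-consM-inner : ∀ {n} (c : Vec ℕ (suc n)) B i j → entry (consM c B) (suc i) (suc j) ≡ entry B i j
entry-consM-inner c B i j = cong (λ r → Vec.lookup r (suc j)) (Vec.lookup-map i (0 ∷_) B)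

rowTail-consM-first : ∀ {n} (c : Vec ℕ (suc n)) B → rowTail (consM c B) zero ≡ Vec.sum c
rowTail-consM-first c B = trans (rowTail-masked (consM c B) zero) (maskedSum-all c)

rowTail-consM-inner : ∀ {n} (c : Vec ℕ (suc n)) B j → rowTail (consM c B) (suc j) ≡ rowTail B j
rowTail-consM-inner {n} c B j = begin
  rowTail (consM c B) (suc j)
    ≡⟨ rowTail-masked (consM c B) (suc j) ⟩
  maskedSum n (λ l → toℕ j ℕ.<ᵇ suc (toℕ l)) (λ l → entry (consM c B) (suc j) (suc l))
    ≡⟨ maskedSum-cong n (λ l → <ᵇ-suc (toℕ j) (toℕ l)) (entry-consM-inner c B j) ⟩
  maskedSum n (λ l → does (j Fin.≤? l)) (entry B j)
    ≡⟨ rowTail-masked B j ⟨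
  rowTail B j
    ∎
  where
  open ≡-Reasoning
  <ᵇ-suc : ∀ a b → (a ℕ.<ᵇ suc b) ≡ (a ℕ.≤ᵇ b)
  <ᵇ-suc zero    b = refl
  <ᵇ-suc (suc a) b = refl

colAbove-consM-first : ∀ {n} (c : Vec ℕ (suc n)) B → colAbove (consM c B) zero ≡ 0
colAbove-consM-first {n} c B =
  trans (colAbove-masked (consM c B) zero) (maskedSum-none (suc n) (λ i → entry (consM c B) i zero))

colAbove-consM-inner : ∀ {n} (c : Vec ℕ (suc n)) B j →
  colAbove (consM c B) (suc j) ≡ Vec.lookup c (suc j) + colAbove B j
colAbove-consM-inner {n} c B j = trans (colAbove-masked (consM c B) (suc j))
  (cong (Vec.lookup c (suc j) +_)
        (trans (maskedSum-cong n (λ _ → refl) (λ i → entry-consM-inner c B i j)) (sym (colAbove-masked B j))))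

HasHooks : ∀ {n} → Vec ℕ n → Mat n → Set
HasHooks {n} g A = UpperTriangular A × ((j : Fin n) → rowTail A j ≡ colAbove A j + Vec.lookup g j)

private
  rotate : ∀ x y z → x + (y + z) ≡ (z + x) + y
  rotate = solve-∀

consM-hooks⁺ : ∀ {n} a (g : Vec ℕ n) (c : Vec ℕ (suc n)) B →
  Vec.sum c ≡ a → HasHooks (g ⊕ tail c) B → HasHooks (a ∷ g) (consM c B)
consM-hooks⁺ a g c@(_ ∷ v) B Σc≡a (upper , hooks) = upper′ , hooks′
  where
  upper′ : UpperTriangular (consM c B)
  upper′ zero    j       ()
  upper′ (suc i) zero    _         = entry-consM-below c B i
  upper′ (suc i) (suc j) (s≤s j<i) = trans (entry-consM-inner c B i j) (upper i j j<i)
  hooks′ : ∀ j → rowTail (consM c B) j ≡ colAbove (consM c B) j + Vec.lookup (a ∷ g) j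
  hooks′ zero    = begin
    rowTail (consM c B) zero                 ≡⟨ rowTail-consM-first c B ⟩
    Vec.sum c                                ≡⟨ Σc≡a ⟩
    a                                        ≡⟨ cong (_+ a) (colAbove-consM-first c B) ⟨
    colAbove (consM c B) zero + a            ∎
    where open ≡-Reasoning
  hooks′ (suc j) = begin
    rowTail (consM c B) (suc j)
      ≡⟨ rowTail-consM-inner c B j ⟩
    rowTail B j
      ≡⟨ hooks j ⟩
    colAbove B j + Vec.lookup (g ⊕ v) j
      ≡⟨ cong (colAbove B j +_) (Vec.lookup-zipWith _+_ j g v) ⟩
    colAbove B j + (Vec.lookup g j + Vec.lookup v j)
      ≡⟨ rotate (colAbove B j) (Vec.lookup g j) (Vec.lookup v j) ⟩
    (Vec.lookup v j + colAbove B j) + Vec.lookup g j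
      ≡⟨ cong (_+ Vec.lookup g j) (colAbove-consM-inner c B j) ⟨
    colAbove (consM c B) (suc j) + Vec.lookup g j
      ∎
    where open ≡-Reasoning

consM-hooks⁻ : ∀ {n} a (g : Vec ℕ n) (c : Vec ℕ (suc n)) B →
  HasHooks (a ∷ g) (consM c B) → Vec.sum c ≡ a × HasHooks (g ⊕ tail c) B
consM-hooks⁻ a g c@(_ ∷ v) B (upper , hooks) = Σc≡a , upper′ , hooks′
  where
  Σc≡a : Vec.sum c ≡ a
  Σc≡a = trans (sym (rowTail-consM-first c B)) (trans (hooks zero) (cong (_+ a) (colAbove-consM-first c B)))
  upper′ : UpperTriangular B
  upper′ i j j<i = trans (sym (entry-consM-inner c B i j)) (upper (suc i) (suc j) (s≤s j<i))
  hooks′ : ∀ j → rowTail B j ≡ colAbove B j + Vec.lookup (g ⊕ v) j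
  hooks′ j = begin
    rowTail B j
      ≡⟨ rowTail-consM-inner c B j ⟨
    rowTail (consM c B) (suc j)
      ≡⟨ hooks (suc j) ⟩
    colAbove (consM c B) (suc j) + Vec.lookup g j
      ≡⟨ cong (_+ Vec.lookup g j) (colAbove-consM-inner c B j) ⟩
    (Vec.lookup v j + colAbove B j) + Vec.lookup g j
      ≡⟨ rotate (colAbove B j) (Vec.lookup g j) (Vec.lookup v j) ⟨
    colAbove B j + (Vec.lookup g j + Vec.lookup v j)
      ≡⟨ cong (colAbove B j +_) (Vec.lookup-zipWith _+_ j g v) ⟨
    colAbove B j + Vec.lookup (g ⊕ v) j
      ∎
    where open ≡-Reasoning

-- Every upper-triangular matrix arises from consM: its first column vanishes below the diagonal.
consM-split : ∀ {n} (A : Mat (suc n)) → UpperTriangular A →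
  A ≡ consM (Vec.head A) (Vec.map tail (tail A))
consM-split (r ∷ rows) upper = cong (r ∷_) (zeroColumn rows (λ i → upper (suc i) zero (s≤s z≤n)))
  where
  zeroColumn : ∀ {m n} (rs : Vec (Vec ℕ (suc n)) m) → (∀ i → Vec.lookup (Vec.lookup rs i) zero ≡ 0) →
    rs ≡ Vec.map (0 ∷_) (Vec.map tail rs)
  zeroColumn []               _  = refl
  zeroColumn ((x ∷ r) ∷ rs) x≡0 =
    cong₂ _∷_ (cong (_∷ r) (x≡0 zero)) (zeroColumn rs (λ i → x≡0 (suc i)))

consM-injective : ∀ {n} (c : Vec ℕ (suc n)) {B B′ : Mat n} → consM c B ≡ consM c B′ → B ≡ B′
consM-injective c eq = shifted-injective (Vec.∷-injectiveʳ eq)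
  where
  shifted-injective : ∀ {m n} {B B′ : Vec (Vec ℕ n) m} → Vec.map (0 ∷_) B ≡ Vec.map (0 ∷_) B′ → B ≡ B′
  shifted-injective {B = []}    {[]}      _  = refl
  shifted-injective {B = _ ∷ _} {_ ∷ _} eq =
    cong₂ _∷_ (Vec.∷-injectiveʳ (Vec.∷-injectiveˡ eq)) (shifted-injective (Vec.∷-injectiveʳ eq))

hookMatrices : ∀ {n} → Vec ℕ n → List (Mat n)
withFirstRow : ∀ {n} → Vec ℕ n → Vec ℕ (suc n) → List (Mat (suc n))

hookMatrices []              = [ [] ]
hookMatrices {suc n} (a ∷ g) = concatMap (withFirstRow g) (comps a (suc n))

withFirstRow g c = map (consM c) (hookMatrices (g ⊕ tail c))

hookMatrices-length : ∀ {n} (g : Vec ℕ n) → length (hookMatrices g) ≡ count g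
hookMatrices-length []              = refl
hookMatrices-length {suc n} (a ∷ g) = begin
  length (concatMap (withFirstRow g) (comps a (suc n)))
    ≡⟨ length-concatMap (withFirstRow g) (comps a (suc n)) ⟩
  sum (map (λ c → length (withFirstRow g c)) (comps a (suc n)))
    ≡⟨ cong sum (map-cong block (comps a (suc n))) ⟩
  sum (map (λ c → count (g ⊕ tail c)) (comps a (suc n)))
    ≡⟨ sum-comps a (suc n) (λ c → count (g ⊕ tail c)) ⟩
  count (a ∷ g)
    ∎
  where
  open ≡-Reasoning
  block : ∀ c → length (withFirstRow g c) ≡ count (g ⊕ tail c)
  block c = trans (length-map (consM c) (hookMatrices (g ⊕ tail c))) (hookMatrices-length (g ⊕ tail c))

hookMatrices-sound : ∀ {n} (g : Vec ℕ n) {A} → A ∈ hookMatrices g → HasHooks g A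
hookMatrices-sound [] (here refl) = (λ ()) , (λ ())
hookMatrices-sound {suc n} (a ∷ g) A∈
  with find (∈-concatMap⁻ (withFirstRow g) {xs = comps a (suc n)} A∈)
... | c , c∈ , A∈block with ∈-map⁻ (consM c) A∈block
... | B , B∈ , refl =
  consM-hooks⁺ a g c B (comps-sound a (suc n) c∈) (hookMatrices-sound (g ⊕ tail c) B∈)

hookMatrices-complete : ∀ {n} (g : Vec ℕ n) A → HasHooks g A → A ∈ hookMatrices g
hookMatrices-complete []              [] _ = here refl
hookMatrices-complete {suc n} (a ∷ g) A hasHooks@(upper , _) =
  subst (_∈ hookMatrices (a ∷ g)) (sym A≡) (∈-concatMap⁺ (withFirstRow g) {xs = comps a (suc n)}
    (lose (comps-complete a (suc n) c Σc≡a)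
          (∈-map⁺ (consM c) (hookMatrices-complete (g ⊕ tail c) B B-hooks))))
  where
  c = Vec.head A
  B = Vec.map tail (tail A)
  A≡ = consM-split A upper
  split = consM-hooks⁻ a g c B (subst (HasHooks (a ∷ g)) A≡ hasHooks)
  Σc≡a = proj₁ split
  B-hooks = proj₂ split

hookMatrices-unique : ∀ {n} (g : Vec ℕ n) → Unique (hookMatrices g)
hookMatrices-unique []              = [] ∷ []
hookMatrices-unique {suc n} (a ∷ g) =
  concatMap-unique (withFirstRow g) Vec.head (comps-unique a (suc n))
    (λ c → Unique.map⁺ (consM-injective c) (hookMatrices-unique (g ⊕ tail c)))
    first-row
  where
  first-row : ∀ {c A} → A ∈ withFirstRow g c → Vec.head A ≡ c
  first-row {c} A∈ with ∈-map⁻ (consM c) A∈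
  ... | _ , _ , refl = refl

listBijection : ∀ {X Y : Set} (xs : List X) → Unique xs →
  (embed : Y → X) → (∀ {y y′} → embed y ≡ embed y′ → y ≡ y′) →
  (pick : ∀ {x} → x ∈ xs → Y) → (∀ {x} (x∈ : x ∈ xs) → embed (pick x∈) ≡ x) →
  (∀ y → embed y ∈ xs) → Fin (length xs) ↔ Y
listBijection {X} {Y} xs unique embed embed-injective pick embed-pick member =
  mk↔ₛ′ to from to∘from from∘to
  where
  to : Fin (length xs) → Y
  to i = pick (∈-lookup i)
  from : Y → Fin (length xs)
  from y = Any.index (member y)
  lookup-injective : ∀ {ys : List X} → Unique ys → ∀ i j → List.lookup ys i ≡ List.lookup ys j → i ≡ j
  lookup-injective {_ ∷ _} _            zero    zero    _  = refl
  lookup-injective {_ ∷ _} (y∉ys ∷ _)   zero    (suc j) eq = ⊥-elim (All.lookup y∉ys (∈-lookup j) eq)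
  lookup-injective {_ ∷ _} (y∉ys ∷ _)   (suc i) zero    eq = ⊥-elim (All.lookup y∉ys (∈-lookup i) (sym eq))
  lookup-injective {_ ∷ _} (_ ∷ unique) (suc i) (suc j) eq = cong suc (lookup-injective unique i j eq)
  to∘from : ∀ y → to (from y) ≡ y
  to∘from y = embed-injective (trans (embed-pick (∈-lookup (from y))) (sym (lookup-index (member y))))
  from∘to : ∀ i → from (to i) ≡ i
  from∘to i = lookup-injective unique _ _
    (trans (sym (lookup-index (member (to i)))) (embed-pick (∈-lookup i)))

hookVector : (n k : ℕ) → Vec ℕ n
hookVector zero    k       = []
hookVector (suc n) zero    = 0 ∷ hookVector n zero
hookVector (suc n) (suc k) = 1 ∷ hookVector n k

hookVector-lookup : ∀ n k j → Vec.lookup (hookVector n k) j ≡ onesThenZeros n k j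
hookVector-lookup (suc n) zero    zero    = refl
hookVector-lookup (suc n) zero    (suc j) = hookVector-lookup n zero j
hookVector-lookup (suc n) (suc k) zero    = refl
hookVector-lookup (suc n) (suc k) (suc j) = hookVector-lookup n k j

hookVector-∷ʳ : ∀ n k → k ≤ n → hookVector (suc n) k ≡ hookVector n k ∷ʳ 0
hookVector-∷ʳ zero    zero    _         = refl
hookVector-∷ʳ (suc n) zero    _         = cong (0 ∷_) (hookVector-∷ʳ n zero z≤n)
hookVector-∷ʳ (suc n) (suc k) (s≤s k≤n) = cong (1 ∷_) (hookVector-∷ʳ n k k≤n)

hookVector-sum : ∀ n k → k ≤ n → Vec.sum (hookVector n k) ≡ k
hookVector-sum zero    zero    _         = refl
hookVector-sum (suc n) zero    _         = hookVector-sum n zero z≤n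
hookVector-sum (suc n) (suc k) (s≤s k≤n) = cong suc (hookVector-sum n k k≤n)

minus⇒plus : ∀ r c o → ⁺ r -ℤ ⁺ c ≡ ⁺ o → r ≡ c + o
minus⇒plus r c o eq = ℤ.+-injective (begin
  ⁺ r                           ≡⟨ ℤ.+-identityʳ (⁺ r) ⟨
  ⁺ r +ℤ 0ℤ                     ≡⟨ cong (⁺ r +ℤ_) (ℤ.+-inverseˡ (⁺ c)) ⟨
  ⁺ r +ℤ (-ℤ ⁺ c +ℤ ⁺ c)        ≡⟨ ℤ.+-assoc (⁺ r) (-ℤ ⁺ c) (⁺ c) ⟨
  (⁺ r -ℤ ⁺ c) +ℤ ⁺ c           ≡⟨ cong (_+ℤ ⁺ c) eq ⟩
  ⁺ (o + c)                     ≡⟨ cong ⁺_ (+-comm o c) ⟩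
  ⁺ (c + o)                     ∎)
  where open ≡-Reasoning

plus⇒minus : ∀ r c o → r ≡ c + o → ⁺ r -ℤ ⁺ c ≡ ⁺ o
plus⇒minus _ c o refl = begin
  ⁺ (c + o) -ℤ ⁺ c      ≡⟨ ℤ.[+m]-[+n]≡m⊖n (c + o) c ⟩
  (c + o) ⊖ c           ≡⟨ cong ((c + o) ⊖_) (+-identityʳ c) ⟨
  (c + o) ⊖ (c + 0)     ≡⟨ ℤ.+-cancelˡ-⊖ c o 0 ⟩
  o ⊖ 0                 ≡⟨ ℤ.⊖-≥ z≤n ⟩
  ⁺ o                   ∎
  where open ≡-Reasoning

hookMatrix-enumeration : ∀ n k → Fin (length (hookMatrices (hookVector n k))) ↔ HookMatrix n k
hookMatrix-enumeration n k = listBijection xs (hookMatrices-unique h) HookMatrix.mat mat-injective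
  pick (λ _ → refl) member
  where
  h  = hookVector n k
  xs = hookMatrices h
  open DecMembership (Vec.≡-dec (Vec.≡-dec _≟_)) using (_∈?_)
  mat-injective : ∀ {M M′ : HookMatrix n k} → HookMatrix.mat M ≡ HookMatrix.mat M′ → M ≡ M′
  mat-injective {hookMatrix _ _ _} {hookMatrix _ _ _} refl = refl
  pick : ∀ {A} → A ∈ xs → HookMatrix n k
  pick {A} A∈ = hookMatrix A (proj₁ hasHooks) (λ j → plus⇒minus _ _ _
    (trans (proj₂ hasHooks j) (cong (colAbove A j +_) (hookVector-lookup n k j))))
    where hasHooks = hookMatrices-sound h A∈
  member : ∀ M → HookMatrix.mat M ∈ xs
  member (hookMatrix A upper hooks) = recompute (A ∈? xs) (hookMatrices-complete h A (upper , λ j →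
    trans (minus⇒plus _ _ _ (hooks j)) (cong (colAbove A j +_) (sym (hookVector-lookup n k j)))))

hookCount : ℕ → ℕ → ℕ
hookCount k n = count (hookVector n k)

-- From n = k on, hookVector (n + 1) k only appends a zero hook, and Σ = k.
hookCount-step₁ : ∀ k n → k ≤ n → suc k * hookCount k n ≤ hookCount k (suc n)
hookCount-step₁ k n k≤n =
  subst₂ (λ s h → suc s * hookCount k n ≤ count h) (hookVector-sum n k k≤n) (sym (hookVector-∷ʳ n k k≤n))
         (count-growth (hookVector n k))

hookCount-step₂ : ∀ k → 2 ≤ k → ∀ n → k ≤ n →
  suc k * hookCount k (suc n) + hookCount k n ≤ hookCount k (suc (suc n))
hookCount-step₂ k 2≤k n k≤n =
  subst₂ (λ s h → suc s * count h + hookCount k n ≤ hookCount k (suc (suc n)))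
         (hookVector-sum n k k≤n) (sym (hookVector-∷ʳ n k k≤n))
    (subst (λ h → suc (Vec.sum g) * count₁ g + count g ≤ count h) (sym twoZeros)
      (count₂-growth g (subst (2 ≤_) (sym (hookVector-sum n k k≤n)) 2≤k)))
  where
  g = hookVector n k
  twoZeros : hookVector (suc (suc n)) k ≡ (g ∷ʳ 0) ∷ʳ 0
  twoZeros = trans (hookVector-∷ʳ (suc n) k (m≤n⇒m≤1+n k≤n)) (cong (_∷ʳ 0) (hookVector-∷ʳ n k k≤n))

-- T(1^k, 0^(k + d)) ≥ (k + 1)^(k + d) once d ≥ (k + 1)^(k + 1); for k = 1 first-order
-- growth already suffices.
hookCount-bound : ∀ k → 1 ≤ k → ∀ d → suc k ^ suc k ≤ d → suc k ^ (k + d) ≤ hookCount k (k + suc d)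
hookCount-bound (suc zero) _ d _ = geometric (suc d)
  where open SequenceGrowth 2 1 (hookCount 1) (count-positive (hookVector 1 1)) (hookCount-step₁ 1)
hookCount-bound k@(suc (suc _)) _ d K^[k+1]≤d = eventually d K^[k+1]≤d
  where
  open SequenceGrowth (suc k) k (hookCount k) (count-positive (hookVector k k)) (hookCount-step₁ k)
  open SecondOrder (hookCount-step₂ k (s≤s (s≤s z≤n)))

hookCount-eventually : ∀ k → 1 ≤ k → ∀ n → k + suc (suc k ^ suc k) ≤ n → suc k ^ (n ∸ 1) ≤ hookCount k n
hookCount-eventually k 1≤k n N≤n with m≤n⇒∃[o]m+o≡n N≤n
... | o , refl = subst₂ (λ e i → suc k ^ e ≤ hookCount k i) exponent index
                        (hookCount-bound k 1≤k (M + o) (m≤m+n M o))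
  where
  M = suc k ^ suc k
  index : k + suc (M + o) ≡ k + suc M + o
  index = sym (+-assoc k (suc M) o)
  exponent : k + (M + o) ≡ k + suc M + o ∸ 1
  exponent = cong (_∸ 1) (trans (sym (+-suc k (M + o))) index)

mainTheorem16 : (k : ℕ) → 1 ≤ k →
    ∃[ N ] ((n : ℕ) → N ≤ n →
    Σ ℕ (λ m → (Fin m ↔ HookMatrix n k) × (suc k ^ (n ∸ 1) ≤ m)))
mainTheorem16 k 1≤k = k + suc (suc k ^ suc k) , λ n N≤n →
  _ , hookMatrix-enumeration n k ,
  subst (suc k ^ (n ∸ 1) ≤_) (sym (hookMatrices-length (hookVector n k))) (hookCount-eventually k 1≤k n N≤n)
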